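{- Let $\Gamma$ be the Schreier graph of the action of a group $G$, generated by the symmetric set $S=\{a^{\pm 1}, b^{\pm 1}\}$, on a set $X$ with $|X|=n$, so that $\operatorname{Rot}_{\Gamma}(x,s) = (s(x),s^{ -1})$, with $s\in S$. Let $C_4$ be the cycle graph whose vertices are labelled by $a,a^{ -1},b,b^{ -1}$ with edges $a$–$a^{ -1}$, $a^{ -1}$–$b$, $b$–$b^{ -1}$, $b^{ -1}$–$a$. Then the graph $\Gamma \circ_z C_4$ is connected if and only if the action of $ab^{ -1}$ is transitive on $X$. If this is the case, one has $\Gamma\circ_z C_4 \simeq DC_{2n}$.
   Context: $\Gamma$ is $4$-regular with labels $S$ identified with $[4]$ via $a\mapsto1$, $a^{ -1}\mapsto2$, $b\mapsto3$, $b^{ -1}\mapsto4$; $\operatorname{Rot}(x,s)=(y,t)$ means an edge joining $x,y$ labelled $s$ near $x$ and $t$ near $y$. Zig-zag product $\Gamma\circ_z C_4$: vertex set $X\times[4]$ and rotation map $\operatorname{Rot}((v,k),(i,j))=((w,l),(j',i'))$ whenever $\operatorname{Rot}_{C_4}(k,i)=(k',i')$, $\operatorname{Rot}_\Gamma(v,k')=(w,l')$, $\operatorname{Rot}_{C_4}(l',j)=(l,j')$. The double cycle graph $DC_m$ is the $4$-regular graph on $2m$ vertices $x_0,\dots,x_{m-1},y_0,\dots,y_{m-1}$ in which each of $x_t,y_t$ is adjacent to each of $x_{t+1},y_{t+1}$ (indices mod $m$). -}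

module Defs where

open import Data.Nat using (ℕ; zero; suc; _+_; _*_)
import Data.Nat as ℕ
open import Data.Fin using (Fin; zero; suc; toℕ)
import Data.Fin.Properties as FinP
open import Data.Fin.Permutation using (Permutation′; _⟨$⟩ʳ_; _⟨$⟩ˡ_)
open import Data.Product using (_×_; _,_; proj₁; proj₂; ∃; ∃-syntax; Σ-syntax)
open import Data.Product.Properties using (≡-dec)
open import Data.Bool using (Bool; true; false; if_then_else_; _∨_; _∧_)
open import Data.List using (List; []; _∷_; map)
open import Data.Nat.ListAction using (sum)
open import Relation.Nullary.Decidable using (⌊_⌋)
open import Relation.Binary.PropositionalEquality using (_≡_)
open import Function using (_∘_; _↔_)
open import Function.Bundles using (Inverse)

RotMap : Set → Set → Set
RotMap V L = V × L → V × L

data Reachable {V L : Set} (rot : RotMap V L) : V → V → Set where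
  here : ∀ {u} → Reachable rot u u
  step : ∀ {u v} (ℓ : L) → Reachable rot (proj₁ (rot (u , ℓ))) v → Reachable rot u v

Connected : {V L : Set} → RotMap V L → Set
Connected {V} rot = (u v : V) → Reachable rot u v

-- The Schreier graph Γ of ⟨a, b⟩ acting on X = Fin n.
-- Labels: a ↦ 0, a⁻¹ ↦ 1, b ↦ 2, b⁻¹ ↦ 3  (i.e. [4] shifted down by one).

act : {n : ℕ} → Permutation′ n → Permutation′ n → Fin 4 → Fin n → Fin n
act a b zero                   x = a ⟨$⟩ʳ x
act a b (suc zero)             x = a ⟨$⟩ˡ x
act a b (suc (suc zero))       x = b ⟨$⟩ʳ x
act a b (suc (suc (suc zero))) x = b ⟨$⟩ˡ x

invLabel : Fin 4 → Fin 4
invLabel zero                   = suc zero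
invLabel (suc zero)             = zero
invLabel (suc (suc zero))       = suc (suc (suc zero))
invLabel (suc (suc (suc zero))) = suc (suc zero)

rotΓ : {n : ℕ} → Permutation′ n → Permutation′ n → RotMap (Fin n) (Fin 4)
rotΓ a b (x , s) = act a b s x , invLabel s

-- The cycle C₄ on vertices a, a⁻¹, b, b⁻¹ (= 0,1,2,3) with edges
-- a–a⁻¹, a⁻¹–b, b–b⁻¹, b⁻¹–a.

fwd : Fin 4 → Fin 4
fwd zero                   = suc zero
fwd (suc zero)             = suc (suc zero)
fwd (suc (suc zero))       = suc (suc (suc zero))
fwd (suc (suc (suc zero))) = zero

bwd : Fin 4 → Fin 4
bwd zero                   = suc (suc (suc zero))
bwd (suc zero)             = zero
bwd (suc (suc zero))       = suc zero
bwd (suc (suc (suc zero))) = suc (suc zero)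

rotC4 : RotMap (Fin 4) (Fin 2)
rotC4 (k , zero)     = fwd k , suc zero
rotC4 (k , suc zero) = bwd k , zero

zigzag : {V D d : Set} → RotMap V D → RotMap D d → RotMap (V × D) (d × d)
zigzag rotG rotH ((v , k) , (i , j)) with rotH (k , i)
... | (k′ , i′) with rotG (v , k′)
... | (w , l′) with rotH (l′ , j)
... | (l , j′) = (w , l) , (j′ , i′)

zzRot : {n : ℕ} → Permutation′ n → Permutation′ n → RotMap (Fin n × Fin 4) (Fin 2 × Fin 2)
zzRot a b = zigzag (rotΓ a b) rotC4

zzLabels : List (Fin 2 × Fin 2)
zzLabels = (zero , zero) ∷ (zero , suc zero) ∷ (suc zero , zero) ∷ (suc zero , suc zero) ∷ []

zzAdj : {n : ℕ} → Permutation′ n → Permutation′ n → Fin n × Fin 4 → Fin n × Fin 4 → ℕ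
zzAdj a b u v =
  sum (map (λ ℓ → if ⌊ ≡-dec FinP._≟_ FinP._≟_ (proj₁ (zzRot a b (u , ℓ))) v ⌋ then 1 else 0) zzLabels)

-- The double cycle graph DC_m on vertices x_t = (0,t), y_t = (1,t):
-- each of x_t, y_t is adjacent to each of x_{t+1}, y_{t+1} (indices mod m).

isNext : (m : ℕ) → Fin m → Fin m → Bool
isNext m t s = ⌊ suc (toℕ t) ℕ.≟ toℕ s ⌋ ∨ (⌊ suc (toℕ t) ℕ.≟ m ⌋ ∧ ⌊ toℕ s ℕ.≟ 0 ⌋)

dcAdj : (m : ℕ) → Fin 2 × Fin m → Fin 2 × Fin m → ℕ
dcAdj m (_ , t) (_ , s) = (if isNext m t s then 1 else 0) + (if isNext m s t then 1 else 0)

iter : {A : Set} → (A → A) → ℕ → A → A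
iter f zero    x = x
iter f (suc k) x = f (iter f k x)

abInv : {n : ℕ} → Permutation′ n → Permutation′ n → Fin n → Fin n
abInv a b x = a ⟨$⟩ʳ (b ⟨$⟩ˡ x)

TransitiveCyclic : {n : ℕ} → (Fin n → Fin n) → Set
TransitiveCyclic {n} c = (x y : Fin n) → ∃[ k ] iter c k x ≡ y

ZZIsoDC : {n : ℕ} → Permutation′ n → Permutation′ n → Set
ZZIsoDC {n} a b =
  Σ[ f ∈ ((Fin n × Fin 4) ↔ (Fin 2 × Fin (2 * n))) ]
    ((u v : Fin n × Fin 4) → zzAdj a b u v ≡ dcAdj (2 * n) (Inverse.to f u) (Inverse.to f v))

module Submission where

-- The vertices (v, k) of Γ ∘_z C₄ fall into 2n layers (parity k, v): the
-- even layer (0, x) = {(x, a), (x, b)} and the odd layer (1, w) = {(w, a⁻¹), (w, b⁻¹)}.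
-- On layers put σ(0, x) = (1, b⁻¹x) and σ(1, w) = (0, a w), so that
-- σ²(0, x) = (0, c x).  The key local fact (neighbourhood) is that the four
-- neighbours of a vertex in layer L are exactly the two vertices of σ⁻¹L
-- and the two vertices of σL.  From it:
--   * connectivity: walks only move to adjacent layers, which preserves the
--     c-orbit of the next even layer, so connectivity forces c to be transitive;
--     conversely, transitivity of c makes σ transitive and walking forward
--     along σ reaches every vertex;
--   * isomorphism: a transitive injective map on an m-element set is an
--     m-cycle (module Enumeration), so σ numbers the layers by Fin (2n) with
--     σ as the cyclic successor, and the neighbourhood lemma becomes exactly
--     the adjacency of DC_{2n}.

open import Defs
open import Data.Bool using (Bool; true; false; T; if_then_else_)
open import Data.Bool.Properties using (T-∨; T-∧)
open import Data.Empty using (⊥-elim)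
open import Data.Fin using (Fin; zero; suc; toℕ; fromℕ<; combine; remQuot)
open import Data.Fin.Permutation using (Permutation′; _⟨$⟩ʳ_; _⟨$⟩ˡ_; inverseˡ; inverseʳ)
open import Data.Fin.Properties
  using (_≟_; toℕ-fromℕ<; toℕ-injective; toℕ<n; pigeonhole; injective⇒≤; *↔×; remQuot-combine; combine-remQuot)
open import Data.List using (List; []; _∷_; _++_; map)
open import Data.List.Membership.Propositional using (_∈_)
open import Data.List.Membership.Propositional.Properties using (∈-map⁺; ∈-map⁻)
open import Data.List.Properties using (map-++)
open import Data.List.Relation.Binary.Permutation.Propositional using (_↭_; prep; swap; ↭-refl; ↭-sym; ↭-trans)
open import Data.List.Relation.Binary.Permutation.Propositional.Properties
  using (map⁺; ++-comm; ∈-resp-↭)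
open import Data.List.Relation.Unary.Any using (here; there)
open import Data.Nat using (ℕ; zero; suc; _+_; _*_; _≤_; _<_; NonZero; z≤n; s≤s)
import Data.Nat as ℕ
open import Data.Nat.DivMod using (_%_; _/_; m%n<n; m≡m%n+[m/n]*n)
open import Data.Nat.ListAction using (sum)
open import Data.Nat.ListAction.Properties using (sum-++; sum-↭)
open import Data.Nat.Properties
  using (n<1+n; +-comm; +-suc; +-identityʳ; ≤-trans; ≤-antisym; <-irrefl; ≤-<-trans; <-cmp; m≤n+m; m≤n⇒∃[o]m+o≡n; m≤n⇒m<n∨m≡n)
open import Data.Product using (_×_; _,_; proj₁; proj₂; ∃-syntax)
open import Data.Product.Function.NonDependent.Propositional using (_×-↔_)
open import Data.Product.Properties using (≡-dec)
open import Data.Sum using (_⊎_; inj₁; inj₂)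
open import Function using (_∘_; _↔_; Injective)
open import Function.Bundles using (Inverse; Equivalence; _⇔_; mk⇔; mk↔ₛ′)
open import Function.Properties.Inverse using (↔-refl; ↔-sym; ↔-trans)
open import Relation.Binary.Definitions using (DecidableEquality; tri<; tri≈; tri>)
open import Relation.Binary.PropositionalEquality
  using (_≡_; _≢_; refl; sym; trans; cong; cong₂; subst; subst₂; module ≡-Reasoning)
open import Relation.Nullary using (Dec; ¬_)
open import Relation.Nullary.Decidable using (⌊_⌋; toWitness; fromWitness)

-- Iterates and forward orbits of a self-map

Orbit : {A : Set} → (A → A) → A → A → Set
Orbit f x y = ∃[ k ] iter f k x ≡ y

module _ {A : Set} (f : A → A) where

  iter-+ : ∀ i j x → iter f (i + j) x ≡ iter f i (iter f j x)
  iter-+ zero    j x = refl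
  iter-+ (suc i) j x = cong f (iter-+ i j x)

  iter-shift : ∀ k x → iter f k (f x) ≡ iter f (suc k) x
  iter-shift zero    x = refl
  iter-shift (suc k) x = cong f (iter-shift k x)

  iter-injective : Injective _≡_ _≡_ f → ∀ k → Injective _≡_ _≡_ (iter f k)
  iter-injective inj zero    e = e
  iter-injective inj (suc k) e = iter-injective inj k (inj e)

  iter-mod : ∀ d .{{_ : NonZero d}} x → iter f d x ≡ x → ∀ k → iter f k x ≡ iter f (k % d) x
  iter-mod d x ret k = begin
    iter f k x                                 ≡⟨ cong (λ j → iter f j x) (m≡m%n+[m/n]*n k d) ⟩
    iter f (k % d + (k / d) * d) x             ≡⟨ iter-+ (k % d) ((k / d) * d) x ⟩
    iter f (k % d) (iter f ((k / d) * d) x)    ≡⟨ cong (iter f (k % d)) (iter-multiple (k / d)) ⟩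
    iter f (k % d) x                           ∎
    where
    open ≡-Reasoning
    iter-multiple : ∀ q → iter f (q * d) x ≡ x
    iter-multiple zero    = refl
    iter-multiple (suc q) = trans (iter-+ d (q * d) x) (trans (cong (iter f d) (iter-multiple q)) ret)

  orbit-trans : ∀ {x y z} → Orbit f x y → Orbit f y z → Orbit f x z
  orbit-trans {x} (i , refl) (j , refl) = j + i , iter-+ j i x

  orbit-step : ∀ {x y} → Orbit f (f x) y → Orbit f x y
  orbit-step {x} (k , e) = suc k , trans (sym (iter-shift k x)) e

  -- Two equal iterates i < j of an injective f make x return after
  -- j ∸ i steps, a positive number at most j.
  collision : Injective _≡_ _≡_ f → ∀ {i j} x → i < j → iter f i x ≡ iter f j x →
              ∃[ p ] suc p ≤ j × iter f (suc p) x ≡ x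
  collision inj {i} {j} x i<j e with m≤n⇒∃[o]m+o≡n i<j
  ... | p , i+1+p≡j = p , subst (suc p ≤_) i+1+p≡j (s≤s (m≤n+m p i)) , sym returns
    where
    returns : x ≡ iter f (suc p) x
    returns = iter-injective inj i
      (trans e (trans (cong (λ k → iter f k x) (trans (sym i+1+p≡j) (sym (+-suc i p)))) (iter-+ i (suc p) x)))

module _ {A B : Set} (e : A ↔ B) where

  open Inverse e using (to; from; strictlyInverseˡ; strictlyInverseʳ)

  to-injective : Injective _≡_ _≡_ to
  to-injective {x} {y} eq = trans (sym (strictlyInverseʳ x)) (trans (cong from eq) (strictlyInverseʳ y))

  from-injective : Injective _≡_ _≡_ from
  from-injective {i} {j} eq = trans (sym (strictlyInverseˡ i)) (trans (cong to eq) (strictlyInverseˡ j))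

module _ {A : Set} {m : ℕ} (finite : A ↔ Fin m) where

  open Inverse finite using (to)

  -- Recurrence: an injective f returns every point within m steps
  -- (pigeonhole on the first m + 1 iterates).
  recurrence : (f : A → A) → Injective _≡_ _≡_ f → ∀ x → ∃[ p ] suc p ≤ m × iter f (suc p) x ≡ x
  recurrence f inj x with pigeonhole (n<1+n m) (λ j → to (iter f (toℕ j) x))
  ... | i , j , i<j , e with collision f inj x i<j (to-injective finite e)
  ... | p , p<j , ret = p , ≤-trans p<j (ℕ.s≤s⁻¹ (toℕ<n j)) , ret

  orbit-back : (f : A → A) → Injective _≡_ _≡_ f → ∀ {x y} → Orbit f x y → Orbit f (f x) y
  orbit-back f inj {x} (suc k , e) = k , trans (iter-shift f k x) e
  orbit-back f inj {x} (zero  , refl) with recurrence f inj x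
  ... | p , _ , ret = p , trans (iter-shift f p x) ret

NextIndex : (m : ℕ) → Fin m → Fin m → Set
NextIndex m i j = suc (toℕ i) ≡ toℕ j ⊎ (suc (toℕ i) ≡ m × toℕ j ≡ 0)

isNext-reflects : ∀ m i j → T (isNext m i j) → NextIndex m i j
isNext-reflects m i j t with Equivalence.to (T-∨ {⌊ suc (toℕ i) ℕ.≟ toℕ j ⌋}) t
... | inj₁ t₁ = inj₁ (toWitness t₁)
... | inj₂ t₂ with Equivalence.to (T-∧ {⌊ suc (toℕ i) ℕ.≟ m ⌋}) t₂
...   | t₃ , t₄ = inj₂ (toWitness t₃ , toWitness t₄)

isNext-complete : ∀ m i j → NextIndex m i j → T (isNext m i j)
isNext-complete m i j (inj₁ e) =
  Equivalence.from (T-∨ {⌊ suc (toℕ i) ℕ.≟ toℕ j ⌋}) (inj₁ (fromWitness e))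
isNext-complete m i j (inj₂ (e₁ , e₂)) =
  Equivalence.from (T-∨ {⌊ suc (toℕ i) ℕ.≟ toℕ j ⌋})
    (inj₂ (Equivalence.from (T-∧ {⌊ suc (toℕ i) ℕ.≟ m ⌋}) (fromWitness e₁ , fromWitness e₂)))

-- A transitive injective map on an m-element set is an m-cycle:
-- the iterates of a base point x₀ enumerate the set by Fin m, and f
-- becomes the cyclic successor.

module Enumeration {A : Set} {m : ℕ} .{{_ : NonZero m}} (finite : A ↔ Fin m)
                   (f : A → A) (f-injective : Injective _≡_ _≡_ f)
                   (transitive : ∀ x y → Orbit f x y) (x₀ : A) where

  open Inverse finite using (from)

  pt : Fin m → A
  pt i = iter f (toℕ i) x₀

  steps : A → ℕ
  steps y = proj₁ (transitive x₀ y)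

  reached-mod : ∀ d .{{_ : NonZero d}} → iter f d x₀ ≡ x₀ → ∀ y → iter f (steps y % d) x₀ ≡ y
  reached-mod d ret y = trans (sym (iter-mod f d x₀ ret (steps y))) (proj₂ (transitive x₀ y))

  -- No return happens in fewer than m steps: the orbit covers all m points.
  minimal : ∀ p → iter f (suc p) x₀ ≡ x₀ → m ≤ suc p
  minimal p ret = injective⇒≤ {f = index} index-injective
    where
    index : Fin m → Fin (suc p)
    index i = fromℕ< (m%n<n (steps (from i)) (suc p))
    index-reaches : ∀ i → iter f (toℕ (index i)) x₀ ≡ from i
    index-reaches i = trans (cong (λ k → iter f k x₀) (toℕ-fromℕ< (m%n<n (steps (from i)) (suc p))))
                            (reached-mod (suc p) ret (from i))
    index-injective : Injective _≡_ _≡_ index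
    index-injective {i} {j} e = from-injective finite
      (trans (sym (index-reaches i)) (trans (cong (λ k → iter f (toℕ k) x₀) e) (index-reaches j)))

  distinct-iterates : ∀ {i j} → i < m → j < m → iter f i x₀ ≡ iter f j x₀ → i ≡ j
  distinct-iterates {i} {j} i<m j<m e with <-cmp i j
  ... | tri≈ _ i≡j _ = i≡j
  ... | tri< i<j _ _ = let (p , p<j , ret) = collision f f-injective x₀ i<j e
                       in ⊥-elim (<-irrefl refl (≤-<-trans (minimal p ret) (≤-<-trans p<j j<m)))
  ... | tri> _ _ j<i = let (p , p<i , ret) = collision f f-injective x₀ j<i (sym e)
                       in ⊥-elim (<-irrefl refl (≤-<-trans (minimal p ret) (≤-<-trans p<i i<m)))

  period : iter f m x₀ ≡ x₀
  period with recurrence finite f f-injective x₀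
  ... | p , p<m , ret = subst (λ k → iter f k x₀ ≡ x₀) (≤-antisym p<m (minimal p ret)) ret

  pos : A → Fin m
  pos y = fromℕ< (m%n<n (steps y) m)

  pt-pos : ∀ y → pt (pos y) ≡ y
  pt-pos y = trans (cong (λ k → iter f k x₀) (toℕ-fromℕ< (m%n<n (steps y) m)))
                   (reached-mod m period y)

  pos-pt : ∀ i → pos (pt i) ≡ i
  pos-pt i = toℕ-injective (distinct-iterates (toℕ<n (pos (pt i))) (toℕ<n i) (pt-pos (pt i)))

  enumeration : A ↔ Fin m
  enumeration = mk↔ₛ′ pos pt pos-pt pt-pos

  next-pt : ∀ i j → NextIndex m i j → f (pt i) ≡ pt j
  next-pt i j (inj₁ e)         = cong (λ k → iter f k x₀) e
  next-pt i j (inj₂ (e₁ , e₂)) =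
    trans (cong (λ k → iter f k x₀) e₁) (trans period (cong (λ k → iter f k x₀) (sym e₂)))

  pt-next : ∀ i j → f (pt i) ≡ pt j → NextIndex m i j
  pt-next i j e with m≤n⇒m<n∨m≡n (toℕ<n i)
  ... | inj₁ i+1<m = inj₁ (distinct-iterates i+1<m (toℕ<n j) e)
  ... | inj₂ i+1≡m = inj₂ (i+1≡m , distinct-iterates (toℕ<n j) (≤-<-trans z≤n (toℕ<n i)) ret)
    where
    ret : iter f (toℕ j) x₀ ≡ iter f 0 x₀
    ret = trans (sym e) (trans (cong (λ k → iter f k x₀) i+1≡m) period)

  isNext-pos : ∀ x y → T (isNext m (pos x) (pos y)) ⇔ (f x ≡ y)
  isNext-pos x y = mk⇔
    (λ t → subst₂ Step (pt-pos x) (pt-pos y) (next-pt _ _ (isNext-reflects m _ _ t)))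
    (λ e → isNext-complete m _ _ (pt-next _ _ (subst₂ Step (sym (pt-pos x)) (sym (pt-pos y)) e)))
    where
    Step : A → A → Set
    Step x′ y′ = f x′ ≡ y′

-- Counting occurrences with decidable equality; both zzAdj and dcAdj are such counts.
ind : Bool → ℕ
ind b = if b then 1 else 0

𝟙 : {P : Set} → Dec P → ℕ
𝟙 d = ind ⌊ d ⌋

ind-cong : ∀ {b b′} → (T b → T b′) → (T b′ → T b) → ind b ≡ ind b′
ind-cong {false} {false} _ _ = refl
ind-cong {false} {true}  _ g = ⊥-elim (g _)
ind-cong {true}  {false} f _ = ⊥-elim (f _)
ind-cong {true}  {true}  _ _ = refl

𝟙-cong : ∀ {P Q : Set} → (P → Q) → (Q → P) → (p : Dec P) (q : Dec Q) → 𝟙 p ≡ 𝟙 q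
𝟙-cong f g p q = ind-cong (fromWitness ∘ f ∘ toWitness) (fromWitness ∘ g ∘ toWitness)

𝟙-no : ∀ {P : Set} → ¬ P → (p : Dec P) → 𝟙 p ≡ 0
𝟙-no ¬p p = ind-cong {b′ = false} (¬p ∘ toWitness) (λ ())

occ : {B : Set} → DecidableEquality B → B → List B → ℕ
occ _≟ᴮ_ y xs = sum (map (λ x → 𝟙 (x ≟ᴮ y)) xs)

module _ {B C : Set} (_≟ᴮ_ : DecidableEquality B) (_≟ᶜ_ : DecidableEquality C) where

  occ-map : (g : B → C) → Injective _≡_ _≡_ g → ∀ y xs → occ _≟ᶜ_ (g y) (map g xs) ≡ occ _≟ᴮ_ y xs
  occ-map g inj y []       = refl
  occ-map g inj y (x ∷ xs) = cong₂ _+_ (𝟙-cong inj (cong g) (g x ≟ᶜ g y) (x ≟ᴮ y)) (occ-map g inj y xs)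

module _ {B : Set} (_≟ᴮ_ : DecidableEquality B) where

  occ-↭ : ∀ y {xs ys} → xs ↭ ys → occ _≟ᴮ_ y xs ≡ occ _≟ᴮ_ y ys
  occ-↭ y p = sum-↭ (map⁺ (λ x → 𝟙 (x ≟ᴮ y)) p)

  occ-++ : ∀ y xs ys → occ _≟ᴮ_ y (xs ++ ys) ≡ occ _≟ᴮ_ y xs + occ _≟ᴮ_ y ys
  occ-++ y xs ys =
    trans (cong sum (map-++ (λ x → 𝟙 (x ≟ᴮ y)) xs ys)) (sum-++ (map (λ x → 𝟙 (x ≟ᴮ y)) xs) _)

module _ {V L : Set} {rot : RotMap V L} where

  _▸_ : ∀ {u v w} → Reachable rot u v → Reachable rot v w → Reachable rot u w
  here     ▸ q = q
  step ℓ p ▸ q = step ℓ (p ▸ q)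

-- The layers of Γ ∘_z C₄

module ZigZagLayers {n : ℕ} (a b : Permutation′ n) where

  Vertex : Set
  Vertex = Fin n × Fin 4

  -- (0, x) is the even layer {(x, a), (x, b)}; (1, w) is the odd layer {(w, a⁻¹), (w, b⁻¹)}.
  Layer : Set
  Layer = Fin 2 × Fin n

  c : Fin n → Fin n
  c = abInv a b

  -- A label k ∈ {a, a⁻¹, b, b⁻¹} = {0, 1, 2, 3} is 2 · side k + parity k.
  side parity : Fin 4 → Fin 2
  side k   = proj₁ (remQuot {2} 2 k)
  parity k = proj₂ (remQuot {2} 2 k)

  layer : Vertex → Layer
  layer (v , k) = parity k , v

  split : Vertex ↔ (Fin 2 × Layer)
  split = mk↔ₛ′ (λ (v , k) → side k , layer (v , k)) (λ (s , r , v) → v , combine s r) to-from from-to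
    where
    to-from : ∀ ((s , r , v) : Fin 2 × Layer) → (side (combine s r) , parity (combine s r) , v) ≡ (s , r , v)
    to-from (s , r , v) = cong (λ (s′ , r′) → s′ , r′ , v) (remQuot-combine s r)
    from-to : ∀ ((v , k) : Vertex) → (v , combine (side k) (parity k)) ≡ (v , k)
    from-to (v , k) = cong (v ,_) (combine-remQuot {2} 2 k)

  _≟ᴸ_ : DecidableEquality Layer
  _≟ᴸ_ = ≡-dec _≟_ _≟_

  _≟ˢᴸ_ : DecidableEquality (Fin 2 × Layer)
  _≟ˢᴸ_ = ≡-dec _≟_ _≟ᴸ_

  -- σ moves each layer to the next one; σ² (0, x) = (0, c x).
  σ σ⁻ : Layer → Layer
  σ (zero     , x) = suc zero , b ⟨$⟩ˡ x
  σ (suc zero , w) = zero     , a ⟨$⟩ʳ w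
  σ⁻ (zero     , x) = suc zero , a ⟨$⟩ˡ x
  σ⁻ (suc zero , w) = zero     , b ⟨$⟩ʳ w

  σ-σ⁻ : ∀ L → σ (σ⁻ L) ≡ L
  σ-σ⁻ (zero     , x) = cong (zero ,_) (inverseʳ a)
  σ-σ⁻ (suc zero , w) = cong (suc zero ,_) (inverseˡ b)

  σ⁻-σ : ∀ L → σ⁻ (σ L) ≡ L
  σ⁻-σ (zero     , x) = cong (zero ,_) (inverseʳ b)
  σ⁻-σ (suc zero , w) = cong (suc zero ,_) (inverseˡ a)

  σ-injective : Injective _≡_ _≡_ σ
  σ-injective {L} {L′} e = trans (sym (σ⁻-σ L)) (trans (cong σ⁻ e) (σ⁻-σ L′))

  -- Two σ-steps act as c on even layers.
  evens : ∀ {x y} → Orbit c x y → Orbit σ (zero , x) (zero , y)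
  evens (zero  , refl) = zero , refl
  evens (suc k , refl) = orbit-trans σ (evens (k , refl)) (2 , refl)

  to-even : ∀ L → ∃[ x ] Orbit σ L (zero , x)
  to-even (zero     , x) = x , zero , refl
  to-even (suc zero , w) = a ⟨$⟩ʳ w , 1 , refl

  from-even : ∀ L → ∃[ y ] Orbit σ (zero , y) L
  from-even (zero     , y) = y , zero , refl
  from-even (suc zero , w) = b ⟨$⟩ʳ w , 1 , cong (suc zero ,_) (inverseˡ b)

  σ-transitive : TransitiveCyclic c → ∀ L L′ → Orbit σ L L′
  σ-transitive tr L L′ with to-even L | from-even L′
  ... | x , L→x | y , y→L′ = orbit-trans σ L→x (orbit-trans σ (evens (tr x y)) y→L′)

  nbr : Fin 2 × Fin 2 → Vertex → Vertex
  nbr ℓ u = proj₁ (zzRot a b (u , ℓ))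

  pair : Layer → List (Fin 2 × Layer)
  pair M = (zero , M) ∷ (suc zero , M) ∷ []

  nbhd : Layer → List (Fin 2 × Layer)
  nbhd L = pair (σ⁻ L) ++ pair (σ L)

  swap-last : ∀ {A : Set} {x y z w : A} → x ∷ y ∷ z ∷ w ∷ [] ↭ x ∷ y ∷ w ∷ z ∷ []
  swap-last = prep _ (prep _ (swap _ _ ↭-refl))

  -- The neighbours of u are, as a multiset, the vertices of the layers
  -- before and after its own.  For the labels a, a⁻¹ they are listed as
  -- (0, σ⁻L), (1, σ⁻L), (1, σL), (0, σL); for b, b⁻¹ the two layers come
  -- in the opposite order.
  neighbourhood : ∀ u → map (λ ℓ → Inverse.to split (nbr ℓ u)) zzLabels ↭ nbhd (layer u)
  neighbourhood (v , zero)                 = swap-last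
  neighbourhood (v , suc zero)             = swap-last
  neighbourhood (v , suc (suc zero))       = ↭-trans (++-comm (_ ∷ _ ∷ []) (_ ∷ _ ∷ [])) swap-last
  neighbourhood (v , suc (suc (suc zero))) = ↭-trans (++-comm (_ ∷ _ ∷ []) (_ ∷ _ ∷ [])) swap-last

  label∈ : ∀ ℓ → ℓ ∈ zzLabels
  label∈ (zero     , zero)     = here refl
  label∈ (zero     , suc zero) = there (here refl)
  label∈ (suc zero , zero)     = there (there (here refl))
  label∈ (suc zero , suc zero) = there (there (there (here refl)))

  nbr-layer : ∀ u ℓ → layer (nbr ℓ u) ≡ σ⁻ (layer u) ⊎ layer (nbr ℓ u) ≡ σ (layer u)
  nbr-layer u ℓ =
    in-nbhd (∈-resp-↭ (neighbourhood u) (∈-map⁺ (λ ℓ′ → Inverse.to split (nbr ℓ′ u)) (label∈ ℓ)))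
    where
    in-nbhd : ∀ {x} → x ∈ nbhd (layer u) → proj₂ x ≡ σ⁻ (layer u) ⊎ proj₂ x ≡ σ (layer u)
    in-nbhd (here refl)                         = inj₁ refl
    in-nbhd (there (here refl))                 = inj₁ refl
    in-nbhd (there (there (here refl)))         = inj₂ refl
    in-nbhd (there (there (there (here refl)))) = inj₂ refl
    in-nbhd (there (there (there (there ()))))

  nbr-onto : ∀ u u′ → layer u′ ≡ σ (layer u) → ∃[ ℓ ] nbr ℓ u ≡ u′
  nbr-onto u u′ e
    with ∈-map⁻ (λ ℓ → Inverse.to split (nbr ℓ u)) {xs = zzLabels} (∈-resp-↭ (↭-sym (neighbourhood u)) u′∈nbhd)
    where
    next∈ : ∀ s → (s , σ (layer u)) ∈ nbhd (layer u)
    next∈ zero       = there (there (here refl))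
    next∈ (suc zero) = there (there (there (here refl)))
    u′∈nbhd : Inverse.to split u′ ∈ nbhd (layer u)
    u′∈nbhd = subst (λ M → (side (proj₂ u′) , M) ∈ nbhd (layer u)) (sym e) (next∈ (side (proj₂ u′)))
  ... | ℓ , _ , split-eq = ℓ , sym (to-injective split split-eq)

  _≟ⱽ_ : DecidableEquality Vertex
  _≟ⱽ_ = ≡-dec _≟_ _≟_

  𝟙-same-side : ∀ s M L′ → 𝟙 ((s , M) ≟ˢᴸ (s , L′)) ≡ 𝟙 (M ≟ᴸ L′)
  𝟙-same-side s M L′ = 𝟙-cong (cong proj₂) (cong (s ,_)) _ _

  𝟙-other-side : ∀ {s s′} M L′ → s ≢ s′ → 𝟙 ((s , M) ≟ˢᴸ (s′ , L′)) ≡ 0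
  𝟙-other-side M L′ s≢s′ = 𝟙-no (s≢s′ ∘ cong proj₁) _

  occ-pair : ∀ s M L′ → occ _≟ˢᴸ_ (s , L′) (pair M) ≡ 𝟙 (M ≟ᴸ L′)
  occ-pair zero M L′ =
    trans (cong₂ _+_ (𝟙-same-side zero M L′) (cong (_+ 0) (𝟙-other-side {suc zero} {zero} M L′ (λ ()))))
          (+-identityʳ _)
  occ-pair (suc zero) M L′ =
    cong₂ _+_ (𝟙-other-side {zero} {suc zero} M L′ (λ ()))
              (trans (+-identityʳ _) (𝟙-same-side (suc zero) M L′))

  zz-adjacency : ∀ u v → zzAdj a b u v ≡ 𝟙 (σ⁻ (layer u) ≟ᴸ layer v) + 𝟙 (σ (layer u) ≟ᴸ layer v)
  zz-adjacency u v = begin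
    zzAdj a b u v
      ≡⟨ occ-map _≟ⱽ_ _≟ˢᴸ_ (Inverse.to split) (to-injective split) v (map (λ ℓ → nbr ℓ u) zzLabels) ⟨
    occ _≟ˢᴸ_ (Inverse.to split v) (map (λ ℓ → Inverse.to split (nbr ℓ u)) zzLabels)
      ≡⟨ occ-↭ _≟ˢᴸ_ (Inverse.to split v) (neighbourhood u) ⟩
    occ _≟ˢᴸ_ (Inverse.to split v) (pair (σ⁻ (layer u)) ++ pair (σ (layer u)))
      ≡⟨ occ-++ _≟ˢᴸ_ (Inverse.to split v) (pair (σ⁻ (layer u))) (pair (σ (layer u))) ⟩
    occ _≟ˢᴸ_ (Inverse.to split v) (pair (σ⁻ (layer u))) + occ _≟ˢᴸ_ (Inverse.to split v) (pair (σ (layer u)))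
      ≡⟨ cong₂ _+_ (occ-pair (side (proj₂ v)) _ (layer v)) (occ-pair (side (proj₂ v)) _ (layer v)) ⟩
    𝟙 (σ⁻ (layer u) ≟ᴸ layer v) + 𝟙 (σ (layer u) ≟ᴸ layer v) ∎
    where open ≡-Reasoning

module Connectivity {n : ℕ} (a b : Permutation′ n) where

  open ZigZagLayers a b

  vertexIn : Layer → Vertex
  vertexIn M = Inverse.from split (zero , M)

  layer-vertexIn : ∀ M → layer (vertexIn M) ≡ M
  layer-vertexIn M = cong proj₂ (Inverse.strictlyInverseˡ split (zero , M))

  step-to : ∀ u u′ → layer u′ ≡ σ (layer u) → Reachable (zzRot a b) u u′
  step-to u u′ e with nbr-onto u u′ e
  ... | ℓ , refl = step ℓ here

  walk : ∀ k u u′ → layer u′ ≡ iter σ (suc k) (layer u) → Reachable (zzRot a b) u u′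
  walk zero    u u′ e = step-to u u′ e
  walk (suc k) u u′ e =
    walk k u w (layer-vertexIn _) ▸ step-to w u′ (trans e (cong σ (sym (layer-vertexIn _))))
    where
    w : Vertex
    w = vertexIn (iter σ (suc k) (layer u))

  -- To reach u′ from u, follow σ from layer u up to σ⁻¹(layer u′), then step once more.
  transitive⇒connected : TransitiveCyclic c → Connected (zzRot a b)
  transitive⇒connected tr u u′ with σ-transitive tr (layer u) (σ⁻ (layer u′))
  ... | k , e = walk k u u′ (sym (trans (cong σ e) (σ-σ⁻ (layer u′))))

  c-injective : Injective _≡_ _≡_ c
  c-injective e = from-injective b (to-injective a e)

  -- the point x of the even layer (0, x) at or right after L
  norm : Layer → Fin n
  norm (zero     , x) = x
  norm (suc zero , w) = a ⟨$⟩ʳ w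

  norm-σ : ∀ L → norm (σ L) ≡ norm L ⊎ norm (σ L) ≡ c (norm L)
  norm-σ (zero     , x) = inj₂ refl
  norm-σ (suc zero , w) = inj₁ refl

  orbit-adjacent : ∀ {y} L M → M ≡ σ⁻ L ⊎ M ≡ σ L → Orbit c (norm M) y → Orbit c (norm L) y
  orbit-adjacent L _ (inj₂ refl) o with norm-σ L
  ... | inj₁ e = subst (λ x → Orbit c x _) e o
  ... | inj₂ e = orbit-step c (subst (λ x → Orbit c x _) e o)
  orbit-adjacent L _ (inj₁ refl) o with norm-σ (σ⁻ L)
  ... | inj₁ e = subst (λ x → Orbit c x _) (trans (sym e) (cong norm (σ-σ⁻ L))) o
  ... | inj₂ e = subst (λ x → Orbit c x _) (trans (sym e) (cong norm (σ-σ⁻ L)))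
                       (orbit-back ↔-refl c c-injective o)

  reach-orbit : ∀ {u y} → Reachable (zzRot a b) u (y , zero) → Orbit c (norm (layer u)) y
  reach-orbit     here       = zero , refl
  reach-orbit {u} (step ℓ r) = orbit-adjacent (layer u) (layer (nbr ℓ u)) (nbr-layer u ℓ) (reach-orbit r)

  connectivity : Connected (zzRot a b) ⇔ TransitiveCyclic c
  connectivity = mk⇔ (λ cn x y → reach-orbit (cn (x , zero) (y , zero))) transitive⇒connected

-- For transitive c, the cyclic enumeration of the layers by σ identifies
-- Γ ∘_z C₄ with DC_{2n}: the vertex (v, k) goes to (side k, position of its layer).
module DoubleCycle (n′ : ℕ) (a b : Permutation′ (suc n′)) (transitive : TransitiveCyclic (abInv a b)) where

  open ZigZagLayers a b

  layers-finite : Layer ↔ Fin (2 * suc n′)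
  layers-finite = ↔-sym *↔×

  open Enumeration layers-finite σ σ-injective (σ-transitive transitive) (zero , zero)

  toDC : Vertex ↔ (Fin 2 × Fin (2 * suc n′))
  toDC = ↔-trans split (↔-refl ×-↔ enumeration)

  dc-adjacency : ∀ s s′ L L′ →
                 dcAdj (2 * suc n′) (s , pos L) (s′ , pos L′) ≡ 𝟙 (σ⁻ L ≟ᴸ L′) + 𝟙 (σ L ≟ᴸ L′)
  dc-adjacency s s′ L L′ = trans (cong₂ _+_ forward backward) (+-comm (𝟙 (σ L ≟ᴸ L′)) _)
    where
    open Equivalence
    forward : ind (isNext _ (pos L) (pos L′)) ≡ 𝟙 (σ L ≟ᴸ L′)
    forward = ind-cong (fromWitness ∘ to (isNext-pos L L′)) (from (isNext-pos L L′) ∘ toWitness)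
    backward : ind (isNext _ (pos L′) (pos L)) ≡ 𝟙 (σ⁻ L ≟ᴸ L′)
    backward = ind-cong
      (λ t → fromWitness (trans (cong σ⁻ (sym (to (isNext-pos L′ L) t))) (σ⁻-σ L′)))
      (λ w → from (isNext-pos L′ L) (trans (cong σ (sym (toWitness w))) (σ-σ⁻ L)))

  isomorphism : ZZIsoDC a b
  isomorphism = toDC , λ u v →
    trans (zz-adjacency u v) (sym (dc-adjacency (side (proj₂ u)) (side (proj₂ v)) (layer u) (layer v)))

-- Corollary 6.2 (n ≥ 1 is needed only to enumerate the layers).
corollary6p2 : (n : ℕ) → 1 ≤ n → (a b : Permutation′ n) →
    (Connected (zzRot a b) ⇔ TransitiveCyclic (abInv a b))
    × (TransitiveCyclic (abInv a b) → ZZIsoDC a b)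
corollary6p2 (suc n′) _ a b = Connectivity.connectivity a b , DoubleCycle.isomorphism n′ a b
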